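{- Let $D$ be a strongly connected digraph with at least two vertices and let $T$ be a DFS tree of $D$ rooted at $r$. Let $x_1,\ldots,x_k$ be the out-neighbors of $r$ in $T$, and let $T_1,\ldots,T_k$ be the subtrees of $T$ such that $x_i\in V(T_i)$, $T=\bigcup_{i=1}^k T_i$ and $V(T_i)\cap V(T_j)=\{r\}$ for all $i\neq j$. For each $i$, let $G_{T_i}$ be the undirected graph with vertex set $V(T_i)$ in which $uv$ is an edge whenever there is a backward arc (relative to $T$) between $u$ and $v$ in $D$. Then $\chi_A(D)\leq \max_{i\in\{1,\ldots,k\}}\chi(G_{T_i})$.
   Context: All digraphs are finite and loopless. A digraph is strongly connected if there is a directed path between any ordered pair of distinct vertices. A DFS tree $T$ of $D$ rooted at $r$ is the spanning out-branching (spanning out-tree with root $r$, every other vertex of in-degree $1$) produced by running depth-first search on $D$ starting from $r$. A vertex $v$ is a descendant of $u$ (and $u$ an ancestor of $v$) if there is a directed $uv$-path in $T$. An arc $(u,v)$ of $D$ is a backward arc (relative to $T$) if $u$ is a descendant of $v$. A set of vertices is acyclic if it induces no directed cycle; $\chi_A(D)$ is the minimum number of colors in a vertex coloring of $D$ with all color classes acyclic; $\chi(G)$ is the chromatic number of an undirected graph $G$. -}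

module Defs where

open import Data.Nat using (ℕ; _≤_)
open import Data.Fin using (Fin)
open import Data.Bool using (Bool; true; false)
open import Data.List using (List; []; _∷_; _∷ʳ_; length)
open import Data.List.Membership.Propositional using (_∈_; _∉_)
open import Data.List.Relation.Unary.All using (All)
open import Data.List.Relation.Unary.Linked using (Linked)
open import Data.List.Relation.Unary.Unique.Propositional using (Unique)
open import Data.Product using (Σ; _×_; _,_; ∃)
open import Data.Sum using (_⊎_)
open import Relation.Binary.PropositionalEquality using (_≡_; _≢_)
open import Relation.Binary.Construct.Closure.ReflexiveTransitive using (Star)
open import Relation.Nullary using (¬_)
open import Data.Empty using (⊥)

record Digraph (n : ℕ) : Set where
  field
    adj      : Fin n → Fin n → Bool
    loopless : ∀ v → adj v v ≡ false

open Digraph public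

Arc : ∀ {n} → Digraph n → Fin n → Fin n → Set
Arc D u v = adj D u v ≡ true

StronglyConnected : ∀ {n} → Digraph n → Set
StronglyConnected {n} D = (u v : Fin n) → u ≢ v → Star (Arc D) u v

IsCycle : ∀ {n} → Digraph n → List (Fin n) → Set
IsCycle D []       = ⊥
IsCycle D (x ∷ xs) = Unique (x ∷ xs) × 1 ≤ length xs × Linked (Arc D) ((x ∷ xs) ∷ʳ x)

Acyclic : ∀ {n} → Digraph n → (Fin n → Set) → Set
Acyclic D S = ∀ cyc → IsCycle D cyc → ¬ All S cyc

AcyclicColouring : ∀ {n} → Digraph n → (m : ℕ) → (Fin n → Fin m) → Set
AcyclicColouring D m c = ∀ j → Acyclic D (λ v → c v ≡ j)

AcyclicColourable : ∀ {n} → Digraph n → ℕ → Set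
AcyclicColourable {n} D m = Σ (Fin n → Fin m) (AcyclicColouring D m)

record UGraph (n : ℕ) : Set₁ where
  field
    V : Fin n → Set
    E : Fin n → Fin n → Set

open UGraph public

Colourable : ∀ {n} → UGraph n → ℕ → Set
Colourable {n} G m =
  Σ (Fin n → Fin m) λ c → ∀ u v → V G u → V G v → E G u v → c u ≢ c v

-- Depth-first search (nondeterministic: the next unvisited out-neighbour
-- is chosen arbitrarily, so all DFS trees arise).
-- State: list of visited vertices, stack (head = current vertex),
-- list of tree arcs produced so far.

DFSState : ℕ → Set
DFSState n = List (Fin n) × List (Fin n) × List (Fin n × Fin n)

data DFSStep {n} (D : Digraph n) : DFSState n → DFSState n → Set where
  push : ∀ {vis u st tr v} → Arc D u v → v ∉ vis →
         DFSStep D (vis , u ∷ st , tr) (v ∷ vis , v ∷ u ∷ st , (u , v) ∷ tr)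
  pop  : ∀ {vis u st tr} → (∀ v → Arc D u v → v ∈ vis) →
         DFSStep D (vis , u ∷ st , tr) (vis , st , tr)

IsDFSTree : ∀ {n} → Digraph n → Fin n → List (Fin n × Fin n) → Set
IsDFSTree D r tr =
  ∃ λ vis → Star (DFSStep D) (r ∷ [] , r ∷ [] , []) (vis , [] , tr)

TreeArc : ∀ {n} → List (Fin n × Fin n) → Fin n → Fin n → Set
TreeArc tr u v = (u , v) ∈ tr

-- v is a descendant of u (directed u v-path in T, possibly trivial)
Descendant : ∀ {n} → List (Fin n × Fin n) → Fin n → Fin n → Set
Descendant tr v u = Star (TreeArc tr) u v

BackwardArc : ∀ {n} → Digraph n → List (Fin n × Fin n) → Fin n → Fin n → Set
BackwardArc D tr u v = Arc D u v × Descendant tr u v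

-- V(T_i) for the child x = x_i of r: r together with the descendants of x
SubtreeVertex : ∀ {n} → List (Fin n × Fin n) → Fin n → Fin n → Fin n → Set
SubtreeVertex tr r x v = v ≡ r ⊎ Descendant tr v x

G-T : ∀ {n} → Digraph n → List (Fin n × Fin n) → Fin n → Fin n → UGraph n
G-T D tr r x = record
  { V = SubtreeVertex tr r x
  ; E = λ u v → BackwardArc D tr u v ⊎ BackwardArc D tr v u
  }

module Submission where

-- Give every subtree T_i a proper colouring of G_{T_i}, permuted so that all of them assign
-- the same colour to r; since the T_i meet only in r they glue to a colouring of D. A backward
-- arc has both ends in a common T_i, so it is not monochromatic. Every other arc leads to a
-- vertex that the search finished earlier, so finishing times strictly decrease along a
-- monochromatic walk and no colour class contains a directed cycle.

open import Defs
open import Data.Nat using (ℕ; suc; _≤_; _<_; s≤s)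
open import Data.Nat.Properties using (<-irrefl; <-trans; n<1+n; m<n⇒m<1+n)
open import Data.Fin using (Fin) renaming (zero to fzero; suc to fsuc)
open import Data.Fin.Properties using (_≟_)
import Data.Fin.Permutation.Components as Perm
open import Data.Vec.Functional using (updateAt)
open import Data.Vec.Functional.Properties using (updateAt-updates; updateAt-minimal)
open import Data.List using (List; []; _∷_; _∷ʳ_; length)
open import Data.List.Membership.Propositional using (_∈_; _∉_)
open import Data.List.Relation.Unary.Any using (here; there)
open import Data.List.Relation.Unary.All as All using (All; []; _∷_)
open import Data.List.Relation.Unary.All.Properties using (∷ʳ⁺; ∷ʳ⁻)
open import Data.List.Relation.Unary.AllPairs as AllPairs using (AllPairs; []; _∷_)
open import Data.List.Relation.Unary.Linked using (Linked; []; [-]; _∷_)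
open import Data.List.Relation.Unary.Linked.Properties using (Linked⇒AllPairs)
open import Data.Product using (∃; _×_; _,_; proj₁; proj₂)
open import Data.Product.Properties using (≡-dec)
open import Data.Sum using (_⊎_; inj₁; inj₂)
import Data.Sum as Sum
open import Data.Empty using (⊥-elim)
open import Relation.Binary.PropositionalEquality
  using (_≡_; _≢_; refl; sym; trans; cong; subst; subst₂)
open import Relation.Binary.Construct.Closure.ReflexiveTransitive as Star
  using (Star; ε; _◅_; _◅◅_)
open import Relation.Nullary using (yes; no; recompute)
open import Relation.Nullary.Decidable using (dec-true)

arc-irreflexive : ∀ {n} (D : Digraph n) {u v} → Arc D u v → u ≢ v
arc-irreflexive D {u} a refl with trans (sym a) (loopless D u)
... | ()

another-vertex : ∀ {n} → 2 ≤ n → (r : Fin n) → ∃ λ w → w ≢ r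
another-vertex (s≤s (s≤s _)) fzero    = fsuc fzero , λ ()
another-vertex (s≤s (s≤s _)) (fsuc _) = fzero , λ ()

transpose-matchˡ : ∀ {m} (i j : Fin m) → Perm.transpose i j i ≡ j
transpose-matchˡ i j rewrite dec-true (i ≟ i) refl = refl

transpose-injective : ∀ {m} (i j : Fin m) {k l} →
                      Perm.transpose i j k ≡ Perm.transpose i j l → k ≡ l
transpose-injective i j eq =
  trans (sym (Perm.transpose-inverse j i))
        (trans (cong (Perm.transpose j i) eq) (Perm.transpose-inverse j i))

linked-map-within : ∀ {A : Set} {P : A → Set} {R S : A → A → Set} →
                    (∀ {a b} → P a → P b → R a b → S a b) →
                    ∀ {xs} → All P xs → Linked R xs → Linked S xs
linked-map-within f _                []         = []
linked-map-within f _                [-]        = [-]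
linked-map-within f (pa ∷ pb ∷ pxs) (rab ∷ rs) = f pa pb rab ∷ linked-map-within f (pb ∷ pxs) rs

record OutBranching {n} (tr : List (Fin n × Fin n)) (r : Fin n) : Set where
  field
    parent-unique   : ∀ {a b c} → (a , c) ∈ tr → (b , c) ∈ tr → a ≡ b
    root-parentless : ∀ {a} → (a , r) ∉ tr
    spanning        : ∀ w → Descendant tr w r

module OutBranchingProperties {n} {tr : List (Fin n × Fin n)} {r : Fin n}
                              (B : OutBranching tr r) where

  open OutBranching B

  Parent : Fin n → Fin n → Set
  Parent a b = TreeArc tr b a

  ancestors-comparable : ∀ {w a b} → Star Parent w a → Star Parent w b →
                         Star Parent a b ⊎ Star Parent b a
  ancestors-comparable ε         wb        = inj₁ wb
  ancestors-comparable (p ◅ wa)  ε         = inj₂ (p ◅ wa)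
  ancestors-comparable (p ◅ wa) (p′ ◅ wb) with parent-unique p p′
  ... | refl = ancestors-comparable wa wb

  root-child-minimal : ∀ {x x′} → (r , x) ∈ tr → (r , x′) ∈ tr → Star Parent x x′ → x ≡ x′
  root-child-minimal _  _  ε = refl
  root-child-minimal rx rx′ (p ◅ up) with parent-unique p rx | up
  ... | refl | ε      = ⊥-elim (root-parentless rx′)
  ... | refl | p′ ◅ _ = ⊥-elim (root-parentless p′)

  root-child-unique : ∀ {x x′ w} → (r , x) ∈ tr → (r , x′) ∈ tr →
                      Descendant tr w x → Descendant tr w x′ → x ≡ x′
  root-child-unique rx rx′ d d′
    with ancestors-comparable (Star.reverse (λ a → a) d) (Star.reverse (λ a → a) d′)
  ... | inj₁ up = root-child-minimal rx rx′ up
  ... | inj₂ up = sym (root-child-minimal rx′ rx up)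

  root-child : ∀ w → w ≢ r → ∃ λ x → (r , x) ∈ tr × Descendant tr w x
  root-child w w≢r with spanning w
  ... | ε      = ⊥-elim (w≢r refl)
  ... | a ◅ rw = _ , a , rw

  root-has-child : 2 ≤ n → ∃ λ x → (r , x) ∈ tr
  root-has-child 2≤n with another-vertex 2≤n r
  ... | w , w≢r with root-child w w≢r
  ...   | x , rx , _ = x , rx

  common-subtree : ∀ {u v} → u ≢ v → Descendant tr u v →
                   ∃ λ x → (r , x) ∈ tr × SubtreeVertex tr r x u × SubtreeVertex tr r x v
  common-subtree {u} {v} u≢v d with v ≟ r
  ... | yes refl with root-child u u≢v
  ...   | x , rx , du = x , rx , inj₂ du , inj₁ refl
  common-subtree {u} {v} u≢v d | no v≢r with root-child v v≢r
  ...   | x , rx , dv = x , rx , inj₂ (dv ◅◅ d) , inj₂ dv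

record DFSTree {n} (D : Digraph n) (r : Fin n) (tr : List (Fin n × Fin n)) : Set where
  field
    branching : OutBranching tr r
    finish    : Fin n → ℕ
    backward-or-finish-decreasing : ∀ {u v} → Arc D u v →
                                    Descendant tr u v ⊎ finish v < finish u

module DepthFirstSearch {n} (D : Digraph n) (r : Fin n) where

  record Invariant (vis stack : List (Fin n)) (tr : List (Fin n × Fin n)) : Set where
    field
      finished            : List (Fin n)
      finish              : Fin n → ℕ
      root-visited        : r ∈ vis
      visited-below-root  : ∀ {w} → w ∈ vis → Descendant tr w r
      tree-target-visited : ∀ {a c} → (a , c) ∈ tr → c ∈ vis
      parent-unique       : ∀ {a b c} → (a , c) ∈ tr → (b , c) ∈ tr → a ≡ b
      root-parentless     : ∀ {a} → (a , r) ∉ tr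
      visited-split       : ∀ {w} → w ∈ vis → w ∈ stack ⊎ w ∈ finished
      stack-visited       : ∀ {w} → w ∈ stack → w ∈ vis
      finished-visited    : ∀ {w} → w ∈ finished → w ∈ vis
      stack-unfinished    : ∀ {w} → w ∈ stack → w ∉ finished
      stack-distinct      : AllPairs _≢_ stack
      stack-is-path       : AllPairs (λ a s → Descendant tr a s) stack
      finished-arcs       : ∀ {u v} → u ∈ finished → Arc D u v →
                            v ∈ vis × Descendant tr u v ⊎ v ∈ finished × finish v < finish u
      finish-bound        : ∀ {w} → w ∈ finished → finish w < length finished

  initial : Invariant (r ∷ []) (r ∷ []) []
  initial = record
    { finished            = []
    ; finish              = λ _ → 0
    ; root-visited        = here refl
    ; visited-below-root  = λ { (here refl) → ε }
    ; tree-target-visited = λ ()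
    ; parent-unique       = λ ()
    ; root-parentless     = λ ()
    ; visited-split       = inj₁
    ; stack-visited       = λ p → p
    ; finished-visited    = λ ()
    ; stack-unfinished    = λ _ ()
    ; stack-distinct      = [] ∷ []
    ; stack-is-path       = [] ∷ []
    ; finished-arcs       = λ ()
    ; finish-bound        = λ ()
    }

  extend : ∀ {e : Fin n × Fin n} {tr a b} → Descendant tr a b → Descendant (e ∷ tr) a b
  extend = Star.map there

  push-preserves : ∀ {vis u stack tr v} → Arc D u v → v ∉ vis →
                   Invariant vis (u ∷ stack) tr →
                   Invariant (v ∷ vis) (v ∷ u ∷ stack) ((u , v) ∷ tr)
  push-preserves {vis} {u} {stack} {tr} {v} _ v∉vis I = record
    { finished            = finished
    ; finish              = finish
    ; root-visited        = there root-visited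
    ; visited-below-root  = λ { (here refl) → hang (visited-below-root (stack-visited (here refl))) ; (there p) → extend (visited-below-root p) }
    ; tree-target-visited = λ { (here refl) → here refl ; (there p) → there (tree-target-visited p) }
    ; parent-unique       = λ { (here refl) (here refl) → refl
                              ; (here refl) (there q) → ⊥-elim (v∉vis (tree-target-visited q))
                              ; (there p) (here refl) → ⊥-elim (v∉vis (tree-target-visited p))
                              ; (there p) (there q) → parent-unique p q }
    ; root-parentless     = λ { (here refl) → v∉vis root-visited ; (there p) → root-parentless p }
    ; visited-split       = λ { (here refl) → inj₁ (here refl) ; (there p) → Sum.map₁ there (visited-split p) }
    ; stack-visited       = λ { (here refl) → here refl ; (there p) → there (stack-visited p) }
    ; finished-visited    = λ d → there (finished-visited d)
    ; stack-unfinished    = λ { (here refl) d → v∉vis (finished-visited d) ; (there p) → stack-unfinished p }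
    ; stack-distinct      = All.tabulate (λ p v≡s → v∉vis (subst (_∈ vis) (sym v≡s) (stack-visited p)))
                            ∷ stack-distinct
    ; stack-is-path       = All.tabulate (λ p → hang (u-below p)) ∷ AllPairs.map extend stack-is-path
    ; finished-arcs       = λ d a → Sum.map₁ (λ { (w∈vis , dw) → there w∈vis , extend dw }) (finished-arcs d a)
    ; finish-bound        = finish-bound
    }
    where
    open Invariant I
    u-below : ∀ {s} → s ∈ u ∷ stack → Descendant tr u s
    u-below (here refl) = ε
    u-below (there p)   = All.lookup (AllPairs.head stack-is-path) p
    hang : ∀ {s} → Descendant tr u s → Descendant ((u , v) ∷ tr) v s
    hang d = extend d ◅◅ (here refl ◅ ε)

  pop-preserves : ∀ {vis u stack tr} → (∀ v → Arc D u v → v ∈ vis) →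
                  Invariant vis (u ∷ stack) tr → Invariant vis stack tr
  pop-preserves {vis} {u} {stack} {tr} closed I = record
    { finished            = u ∷ finished
    ; finish              = finish′
    ; root-visited        = root-visited
    ; visited-below-root  = visited-below-root
    ; tree-target-visited = tree-target-visited
    ; parent-unique       = parent-unique
    ; root-parentless     = root-parentless
    ; visited-split       = λ p → split (visited-split p)
    ; stack-visited       = λ p → stack-visited (there p)
    ; finished-visited    = λ { (here refl) → stack-visited (here refl) ; (there d) → finished-visited d }
    ; stack-unfinished    = λ { p (here refl) → All.lookup (AllPairs.head stack-distinct) p refl
                              ; p (there d) → stack-unfinished (there p) d }
    ; stack-distinct      = AllPairs.tail stack-distinct
    ; stack-is-path       = AllPairs.tail stack-is-path
    ; finished-arcs       = arcs
    ; finish-bound        = bound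
    }
    where
    open Invariant I
    N = length finished
    finish′ = updateAt finish u (λ _ → N)

    finish′-u : finish′ u ≡ N
    finish′-u = updateAt-updates u finish

    finish′-unchanged : ∀ {w} → w ∈ finished → finish′ w ≡ finish w
    finish′-unchanged {w} d = updateAt-minimal w u finish λ { refl → stack-unfinished (here refl) d }

    split : ∀ {w} → w ∈ u ∷ stack ⊎ w ∈ finished → w ∈ stack ⊎ w ∈ u ∷ finished
    split (inj₁ (here refl)) = inj₂ (here refl)
    split (inj₁ (there p))   = inj₁ p
    split (inj₂ d)           = inj₂ (there d)

    arcs : ∀ {a b} → a ∈ u ∷ finished → Arc D a b →
           b ∈ vis × Descendant tr a b ⊎ b ∈ u ∷ finished × finish′ b < finish′ a
    arcs {b = b} (here refl) ab with visited-split (closed b ab)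
    ... | inj₁ (here refl) = ⊥-elim (arc-irreflexive D ab refl)
    ... | inj₁ (there p)   = inj₁ (stack-visited (there p) , All.lookup (AllPairs.head stack-is-path) p)
    ... | inj₂ d           = inj₂ (there d , subst₂ _<_ (sym (finish′-unchanged d)) (sym finish′-u) (finish-bound d))
    arcs (there da) ab with finished-arcs da ab
    ... | inj₁ backward     = inj₁ backward
    ... | inj₂ (db , lt) = inj₂ (there db , subst₂ _<_ (sym (finish′-unchanged db)) (sym (finish′-unchanged da)) lt)

    bound : ∀ {w} → w ∈ u ∷ finished → finish′ w < suc N
    bound (here refl) = subst (_< suc N) (sym finish′-u) (n<1+n N)
    bound (there d)   = subst (_< suc N) (sym (finish′-unchanged d)) (m<n⇒m<1+n (finish-bound d))

  run-preserves : ∀ {vis stack tr vis′ stack′ tr′} →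
                  Star (DFSStep D) (vis , stack , tr) (vis′ , stack′ , tr′) →
                  Invariant vis stack tr → Invariant vis′ stack′ tr′
  run-preserves ε                       I = I
  run-preserves (push a v∉vis ◅ steps) I = run-preserves steps (push-preserves a v∉vis I)
  run-preserves (pop closed ◅ steps)    I = run-preserves steps (pop-preserves closed I)

  -- With an empty stack every visited vertex is finished, so the visited set is closed under arcs.
  complete-run : ∀ {vis tr} → StronglyConnected D → Invariant vis [] tr → DFSTree D r tr
  complete-run {vis} {tr} sc I = record
    { branching = record
      { parent-unique   = parent-unique
      ; root-parentless = root-parentless
      ; spanning        = λ w → visited-below-root (all-visited w)
      }
    ; finish    = finish
    ; backward-or-finish-decreasing = λ {u} a →
        Sum.map proj₂ proj₂ (finished-arcs (visited-finished (all-visited u)) a)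
    }
    where
    open Invariant I

    visited-finished : ∀ {w} → w ∈ vis → w ∈ finished
    visited-finished p with visited-split p
    ... | inj₂ d = d

    reach-visited : ∀ {a b} → a ∈ vis → Star (Arc D) a b → b ∈ vis
    reach-visited p ε        = p
    reach-visited p (a ◅ as) with finished-arcs (visited-finished p) a
    ... | inj₁ (q , _) = reach-visited q as
    ... | inj₂ (d , _) = reach-visited (finished-visited d) as

    all-visited : ∀ w → w ∈ vis
    all-visited w with w ≟ r
    ... | yes refl = root-visited
    ... | no w≢r   = reach-visited root-visited (sc r w λ r≡w → w≢r (sym r≡w))

dfs-tree : ∀ {n} {D : Digraph n} {r tr} → StronglyConnected D → IsDFSTree D r tr → DFSTree D r tr
dfs-tree {D = D} {r} sc (_ , steps) =
  complete-run sc (run-preserves steps initial)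
  where open DepthFirstSearch D r

-- Along a non-backward arc the finishing time drops, so a cycle inside a colour class would
-- have to contain a backward arc.
backward-bichromatic⇒acyclic :
  ∀ {n m} (D : Digraph n) (tr : List (Fin n × Fin n)) (finish : Fin n → ℕ) →
  (∀ {u v} → Arc D u v → Descendant tr u v ⊎ finish v < finish u) →
  (c : Fin n → Fin m) → (∀ {u v} → BackwardArc D tr u v → c u ≢ c v) →
  AcyclicColouring D m c
backward-bichromatic⇒acyclic D tr finish classify c bichromatic j [] ()
backward-bichromatic⇒acyclic D tr finish classify c bichromatic j (x ∷ xs) (_ , _ , arcs) in-class =
  <-irrefl refl (proj₂ (∷ʳ⁻ (AllPairs.head (Linked⇒AllPairs (λ p q → <-trans q p) descending))))
  where
  monochromatic-descends : ∀ {u v} → c u ≡ j → c v ≡ j → Arc D u v → finish v < finish u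
  monochromatic-descends cu cv a with classify a
  ... | inj₁ d  = ⊥-elim (bichromatic (a , d) (trans cu (sym cv)))
  ... | inj₂ lt = lt

  descending : Linked (λ u v → finish v < finish u) (x ∷ xs ∷ʳ x)
  descending = linked-map-within monochromatic-descends (∷ʳ⁺ in-class (All.head in-class)) arcs

-- Each subtree colouring is composed with the transposition that moves the colour of r to ρ,
-- so that all of them agree at r.
module SubtreeColourings {n m} (D : Digraph n) {tr : List (Fin n × Fin n)} {r : Fin n}
                         (B : OutBranching tr r)
                         (col : ∀ x → (r , x) ∈ tr → Colourable (G-T D tr r x) m)
                         (ρ : Fin m) where

  open OutBranchingProperties B
  open import Data.List.Membership.DecPropositional (≡-dec (_≟_ {n}) (_≟_ {n})) using (_∈?_)

  -- Recomputing the membership proof makes the colouring independent of which proof is given.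
  κ : ∀ x → .((r , x) ∈ tr) → Fin n → Fin m
  κ x rx = proj₁ (col x (recompute ((r , x) ∈? tr) rx))

  κ-proper : ∀ x .(rx : (r , x) ∈ tr) {u v} → SubtreeVertex tr r x u → SubtreeVertex tr r x v →
             BackwardArc D tr u v → κ x rx u ≢ κ x rx v
  κ-proper x rx su sv b = proj₂ (col x (recompute ((r , x) ∈? tr) rx)) _ _ su sv (inj₁ b)

  recoloured : ∀ x → .((r , x) ∈ tr) → Fin n → Fin m
  recoloured x rx w = Perm.transpose (κ x rx r) ρ (κ x rx w)

  colouring : Fin n → Fin m
  colouring w with w ≟ r
  ... | yes _  = ρ
  ... | no w≢r = recoloured (proj₁ (root-child w w≢r)) (proj₁ (proj₂ (root-child w w≢r))) w

  colouring-on-subtree : ∀ x .(rx : (r , x) ∈ tr) {w} → SubtreeVertex tr r x w →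
                         colouring w ≡ recoloured x rx w
  colouring-on-subtree x rx {w} sw with w ≟ r
  ... | yes refl = sym (transpose-matchˡ (κ x rx r) ρ)
  ... | no w≢r with root-child w w≢r | sw
  ...   | _             | inj₁ w≡r = ⊥-elim (w≢r w≡r)
  ...   | x′ , rx′ , dx′ | inj₂ dx with root-child-unique rx′ (recompute ((r , x) ∈? tr) rx) dx′ dx
  ...     | refl = refl

  backward-bichromatic : ∀ {u v} → BackwardArc D tr u v → colouring u ≢ colouring v
  backward-bichromatic (a , d) cu≡cv with common-subtree (arc-irreflexive D a) d
  ... | x , rx , su , sv =
    κ-proper x rx su sv (a , d)
      (transpose-injective (κ x rx r) ρ
        (trans (sym (colouring-on-subtree x rx su)) (trans cu≡cv (colouring-on-subtree x rx sv))))

proposition2 : ∀ {n} (D : Digraph n) → 2 ≤ n → StronglyConnected D →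
    (r : Fin n) (tr : List (Fin n × Fin n)) → IsDFSTree D r tr →
    (m : ℕ) → (∀ x → (r , x) ∈ tr → Colourable (G-T D tr r x) m) →
    AcyclicColourable D m
proposition2 D 2≤n sc r tr dfs m col =
  colouring , backward-bichromatic⇒acyclic D tr finish backward-or-finish-decreasing
                                           colouring backward-bichromatic
  where
  T = dfs-tree sc dfs
  open DFSTree T
  x₀ = proj₁ (OutBranchingProperties.root-has-child branching 2≤n)
  rx₀ = proj₂ (OutBranchingProperties.root-has-child branching 2≤n)
  open SubtreeColourings D branching col (proj₁ (col x₀ rx₀) r)
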